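{- Let $\Gamma_1$ and $\Gamma_2$ be greedoids with disjoint ground sets $E_1$ and $E_2$, and let $\Gamma_1\approx\Gamma_2$ be the full rank attachment of $\Gamma_2$ to $\Gamma_1$. Then \[T(\Gamma_1\approx\Gamma_2;x,y)=T(\Gamma_1;x,y)(x-1)^{\rho(\Gamma_2)}y^{|E_2|}+T(\Gamma_1;1,y)\big(T(\Gamma_2;x,y)-(x-1)^{\rho(\Gamma_2)}y^{|E_2|}\big).\]
   Context: A greedoid is a pair $\Gamma=(E,\mathcal F)$ with $E$ finite and $\mathcal F\subseteq 2^E$ (the feasible sets) such that $\emptyset\in\mathcal F$ and for all $F,F'\in\mathcal F$ with $|F'|<|F|$ there is $x\in F-F'$ with $F'\cup\{x\}\in\mathcal F$. The rank is $\rho(A)=\max\{|A'|:A'\subseteq A,A'\in\mathcal F\}$, $\rho(\Gamma)=\rho(E)$, and $T(\Gamma;x,y)=\sum_{A\subseteq E}(x-1)^{\rho(\Gamma)-\rho(A)}(y-1)^{|A|-\rho(A)}$. For $\Gamma_1=(E_1,\mathcal F_1)$ and $\Gamma_2=(E_2,\mathcal F_2)$ with $E_1\cap E_2=\emptyset$, the full rank attachment $\Gamma_1\approx\Gamma_2$ has ground set $E_1\cup E_2$, and a set $F$ is feasible iff either $F\in\mathcal F_1$, or $F\cap E_1\in\mathcal F_1$, $F\cap E_2\in\mathcal F_2$ and $\rho_{\Gamma_1}(F\cap E_1)=\rho(\Gamma_1)$. -}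

module Defs where

open import Data.Bool using (Bool; true; false; if_then_else_; _∧_; _∨_; not)
open import Data.Nat using (ℕ; zero; suc; _+_; _∸_; _<_; _⊔_; _≡ᵇ_)
open import Data.Integer as ℤ using (ℤ)
open import Data.Fin using (Fin)
open import Data.Fin.Subset using (Subset; ⊥; ⊤; ⁅_⁆; _∪_; _∈_; _∉_; ∣_∣)
open import Data.Vec using (Vec; []; _∷_; take; drop)
open import Data.List using (List; []; _∷_; map; _++_; foldr)
open import Data.Product using (∃; _×_)
open import Relation.Binary.PropositionalEquality using (_≡_)

SetSystem : ℕ → Set
SetSystem n = Subset n → Bool

record IsGreedoid {n : ℕ} (feasible : SetSystem n) : Set where
  field
    empty-feasible : feasible ⊥ ≡ true
    exchange : ∀ (F F' : Subset n) → feasible F ≡ true → feasible F' ≡ true →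
               ∣ F' ∣ < ∣ F ∣ →
               ∃ λ (x : Fin n) → x ∈ F × x ∉ F' × feasible (F' ∪ ⁅ x ⁆) ≡ true

record Greedoid (n : ℕ) : Set where
  field
    feasible   : SetSystem n
    isGreedoid : IsGreedoid feasible
open Greedoid public

subsetsOf : ∀ {n} → Subset n → List (Subset n)
subsetsOf []          = [] ∷ []
subsetsOf (true ∷ A)  = map (true ∷_) (subsetsOf A) ++ map (false ∷_) (subsetsOf A)
subsetsOf (false ∷ A) = map (false ∷_) (subsetsOf A)

allSubsets : ∀ n → List (Subset n)
allSubsets n = subsetsOf ⊤

rank : ∀ {n} → SetSystem n → Subset n → ℕ
rank F A = foldr (λ S m → if F S then ∣ S ∣ ⊔ m else m) 0 (subsetsOf A)

fullRank : ∀ {n} → SetSystem n → ℕ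
fullRank F = rank F ⊤

sumℤ : List ℤ → ℤ
sumℤ = foldr ℤ._+_ (ℤ.+ 0)

tutte : ∀ {n} → SetSystem n → ℤ → ℤ → ℤ
tutte {n} F x y =
  sumℤ (map (λ A → ((x ℤ.- ℤ.+ 1) ℤ.^ (fullRank F ∸ rank F A))
                   ℤ.* ((y ℤ.- ℤ.+ 1) ℤ.^ (∣ A ∣ ∸ rank F A)))
            (allSubsets n))

-- Full rank attachment Γ₁ ≈ Γ₂ on ground set Fin (n₁ + n₂), where the first n₁
-- elements form E₁ and the last n₂ form E₂.
isEmpty : ∀ {n} → Subset n → Bool
isEmpty []          = true
isEmpty (true ∷ A)  = false
isEmpty (false ∷ A) = isEmpty A

fullRankAttach : ∀ {n₁ n₂} → SetSystem n₁ → SetSystem n₂ → SetSystem (n₁ + n₂)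
fullRankAttach {n₁} F₁ F₂ A =
  (isEmpty (drop n₁ A) ∧ F₁ (take n₁ A))
  ∨ (F₁ (take n₁ A) ∧ F₂ (drop n₁ A) ∧ (rank F₁ (take n₁ A) ≡ᵇ fullRank F₁))

-- Write E = E₁ ∪ E₂ and A = A₁ ∪ A₂ with Aᵢ ⊆ Eᵢ.  A feasible set of Γ₁ ≈ Γ₂ is a
-- feasible set of Γ₁, possibly extended by a feasible set of Γ₂ once its Γ₁-part has
-- full rank.  Hence the rank of A is ρ₁(A₁) + ρ₂(A₂) when ρ₁(A₁) = ρ(Γ₁), and ρ₁(A₁)
-- otherwise.  Summing the Tutte terms over A₂ for fixed A₁: in the first case the term
-- factors as the Γ₁-term of A₁ (which then does not depend on x) times the Γ₂-term of
-- A₂, giving T(Γ₂); in the second it is the Γ₁-term times (x-1)^ρ(Γ₂) (y-1)^|A₂|,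
-- which sums to (x-1)^ρ(Γ₂) y^|E₂|, while the Γ₁-term vanishes at x = 1.
module Submission where

open import Defs
open import Data.Nat using (ℕ)
open import Data.Integer using (ℤ; +_; _+_; _-_; _*_; _^_)
open import Relation.Binary.PropositionalEquality using (_≡_)

open import Data.Bool as Bool using (Bool; true; false; if_then_else_; _∧_; _∨_; f≤t; b≤b)
open import Data.Bool.Properties as Boolₚ using (T-≡; ∨-zeroʳ)
open import Data.Empty using (⊥-elim)
open import Data.Fin.Subset using (Subset; ∣_∣; ⊤; ⊥)
open import Data.Fin.Subset.Properties using (∣⊥∣≡0)
import Data.Integer.Properties as ℤ
open import Data.Integer.Tactic.RingSolver using (solve-∀)
open import Data.List using (List; []; _∷_; map; _++_; foldr)
open import Data.List.Properties using (map-++; map-∘; map-cong)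
open import Data.List.Membership.Propositional using (_∈_)
open import Data.List.Membership.Propositional.Properties using (∈-++⁻; ∈-++⁺ˡ; ∈-++⁺ʳ; ∈-map⁻; ∈-map⁺)
open import Data.List.Relation.Unary.Any using (here; there)
import Data.Nat as ℕ
open import Data.Nat.Properties as ℕ using (module ≤-Reasoning)
open import Data.Product using (_×_; _,_; ∃)
open import Data.Sum using (_⊎_; inj₁; inj₂; [_,_]′)
open import Data.Vec as Vec using (Vec; replicate; take; drop)
open import Data.Vec.Properties using (take++drop≡id; ++-injectiveˡ; ++-injectiveʳ)
open import Data.Vec.Relation.Binary.Pointwise.Inductive as Pointwise using (Pointwise; []; _∷_)
open import Function using (_∘_)
open import Function.Bundles using (Equivalence)
open import Relation.Binary.PropositionalEquality using (refl; sym; trans; cong; cong₂; subst; _≢_; module ≡-Reasoning)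
open import Relation.Nullary using (yes; no)

++-elim : ∀ {a} {A : Set a} {m n} (P : Vec A (m ℕ.+ n) → Set) →
          (∀ xs ys → P (xs Vec.++ ys)) → ∀ zs → P zs
++-elim {m = m} P h zs = subst P (take++drop≡id m zs) (h (take m zs) (drop m zs))

take-++ : ∀ {a} {A : Set a} {m n} (xs : Vec A m) (ys : Vec A n) → take m (xs Vec.++ ys) ≡ xs
take-++ {m = m} xs ys = ++-injectiveˡ _ xs (take++drop≡id m (xs Vec.++ ys))

drop-++ : ∀ {a} {A : Set a} {m n} (xs : Vec A m) (ys : Vec A n) → drop m (xs Vec.++ ys) ≡ ys
drop-++ {m = m} xs ys = ++-injectiveʳ (take m (xs Vec.++ ys)) xs (take++drop≡id m (xs Vec.++ ys))

replicate-++ : ∀ {a} {A : Set a} m {n} (x : A) → replicate (m ℕ.+ n) x ≡ replicate m x Vec.++ replicate n x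
replicate-++ ℕ.zero    x = refl
replicate-++ (ℕ.suc m) x = cong (x Vec.∷_) (replicate-++ m x)

infix 4 _⊑_
_⊑_ : ∀ {n} → Subset n → Subset n → Set
S ⊑ A = Pointwise Bool._≤_ S A

⊑-refl : ∀ {n} {A : Subset n} → A ⊑ A
⊑-refl = Pointwise.refl Boolₚ.≤-refl

⊑-trans : ∀ {n} {S T A : Subset n} → S ⊑ T → T ⊑ A → S ⊑ A
⊑-trans = Pointwise.trans Boolₚ.≤-trans

⊑-min : ∀ {n} (A : Subset n) → ⊥ ⊑ A
⊑-min Vec.[]          = []
⊑-min (true Vec.∷ A)  = f≤t ∷ ⊑-min A
⊑-min (false Vec.∷ A) = b≤b ∷ ⊑-min A

⊑-max : ∀ {n} (A : Subset n) → A ⊑ ⊤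
⊑-max Vec.[]          = []
⊑-max (true Vec.∷ A)  = b≤b ∷ ⊑-max A
⊑-max (false Vec.∷ A) = f≤t ∷ ⊑-max A

p⊑q⇒∣p∣≤∣q∣ : ∀ {n} {S A : Subset n} → S ⊑ A → ∣ S ∣ ℕ.≤ ∣ A ∣
p⊑q⇒∣p∣≤∣q∣ []                            = ℕ.z≤n
p⊑q⇒∣p∣≤∣q∣ {S = true Vec.∷ _}  (b≤b ∷ p) = ℕ.s≤s (p⊑q⇒∣p∣≤∣q∣ p)
p⊑q⇒∣p∣≤∣q∣ {S = false Vec.∷ _} (b≤b ∷ p) = p⊑q⇒∣p∣≤∣q∣ p
p⊑q⇒∣p∣≤∣q∣                     (f≤t ∷ p) = ℕ.m≤n⇒m≤1+n (p⊑q⇒∣p∣≤∣q∣ p)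

∣p++q∣≡∣p∣+∣q∣ : ∀ {m n} (S₁ : Subset m) (S₂ : Subset n) → ∣ S₁ Vec.++ S₂ ∣ ≡ ∣ S₁ ∣ ℕ.+ ∣ S₂ ∣
∣p++q∣≡∣p∣+∣q∣ Vec.[]           S₂ = refl
∣p++q∣≡∣p∣+∣q∣ (true Vec.∷ S₁)  S₂ = cong ℕ.suc (∣p++q∣≡∣p∣+∣q∣ S₁ S₂)
∣p++q∣≡∣p∣+∣q∣ (false Vec.∷ S₁) S₂ = ∣p++q∣≡∣p∣+∣q∣ S₁ S₂

isEmpty⇒∣p∣≡0 : ∀ {n} (S : Subset n) → isEmpty S ≡ true → ∣ S ∣ ≡ 0
isEmpty⇒∣p∣≡0 Vec.[]          _ = refl
isEmpty⇒∣p∣≡0 (false Vec.∷ S) e = isEmpty⇒∣p∣≡0 S e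

isEmpty-⊥ : ∀ n → isEmpty (⊥ {n}) ≡ true
isEmpty-⊥ ℕ.zero    = refl
isEmpty-⊥ (ℕ.suc n) = isEmpty-⊥ n

subsetsOf-sound : ∀ {n} (A : Subset n) {S} → S ∈ subsetsOf A → S ⊑ A
subsetsOf-sound Vec.[] (here refl) = []
subsetsOf-sound (true Vec.∷ A) S∈ with ∈-++⁻ (map (true Vec.∷_) (subsetsOf A)) S∈
... | inj₁ S∈₁ with ∈-map⁻ (true Vec.∷_) S∈₁
...   | _ , S′∈ , refl = b≤b ∷ subsetsOf-sound A S′∈
subsetsOf-sound (true Vec.∷ A) S∈ | inj₂ S∈₂ with ∈-map⁻ (false Vec.∷_) S∈₂
...   | _ , S′∈ , refl = f≤t ∷ subsetsOf-sound A S′∈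
subsetsOf-sound (false Vec.∷ A) S∈ with ∈-map⁻ (false Vec.∷_) S∈
... | _ , S′∈ , refl = b≤b ∷ subsetsOf-sound A S′∈

subsetsOf-complete : ∀ {n} {S A : Subset n} → S ⊑ A → S ∈ subsetsOf A
subsetsOf-complete [] = here refl
subsetsOf-complete {A = true Vec.∷ A} (b≤b ∷ p) =
  ∈-++⁺ˡ (∈-map⁺ (true Vec.∷_) (subsetsOf-complete p))
subsetsOf-complete {A = true Vec.∷ A} (f≤t ∷ p) =
  ∈-++⁺ʳ (map (true Vec.∷_) (subsetsOf A)) (∈-map⁺ (false Vec.∷_) (subsetsOf-complete p))
subsetsOf-complete {A = false Vec.∷ A} (b≤b ∷ p) =
  ∈-map⁺ (false Vec.∷_) (subsetsOf-complete p)

module _ {X : Set} (p : X → Bool) (w : X → ℕ) where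

  maxWhere : List X → ℕ
  maxWhere = foldr (λ x m → if p x then w x ℕ.⊔ m else m) 0

  maxWhere-upper : ∀ {x xs} → x ∈ xs → p x ≡ true → w x ℕ.≤ maxWhere xs
  maxWhere-upper {xs = _ ∷ _} (here refl) px rewrite px = ℕ.m≤m⊔n _ _
  maxWhere-upper {xs = y ∷ _} (there x∈) px with p y
  ... | true  = ℕ.≤-trans (maxWhere-upper x∈ px) (ℕ.m≤n⊔m _ _)
  ... | false = maxWhere-upper x∈ px

  maxWhere-least : ∀ {r} xs → (∀ {x} → x ∈ xs → p x ≡ true → w x ℕ.≤ r) → maxWhere xs ℕ.≤ r
  maxWhere-least []       _ = ℕ.z≤n
  maxWhere-least (y ∷ xs) h with p y in py
  ... | true  = ℕ.⊔-lub (h (here refl) py) (maxWhere-least xs (h ∘ there))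
  ... | false = maxWhere-least xs (h ∘ there)

  maxWhere-attained : ∀ xs → maxWhere xs ≡ 0 ⊎ ∃ λ x → x ∈ xs × p x ≡ true × w x ≡ maxWhere xs
  maxWhere-attained []       = inj₁ refl
  maxWhere-attained (y ∷ xs) with p y in py | maxWhere-attained xs
  ... | false | inj₁ m≡0               = inj₁ m≡0
  ... | false | inj₂ (x , x∈ , px , e) = inj₂ (x , there x∈ , px , e)
  ... | true  | IH with ℕ.⊔-sel (w y) (maxWhere xs)
  ...   | inj₁ ⊔≡w = inj₂ (y , here refl , py , sym ⊔≡w)
  ...   | inj₂ ⊔≡m with IH
  ...     | inj₁ m≡0               = inj₁ (trans ⊔≡m m≡0)
  ...     | inj₂ (x , x∈ , px , e) = inj₂ (x , there x∈ , px , trans e (sym ⊔≡m))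

module _ {n} (F : SetSystem n) where

  rank-upper : ∀ {S A} → S ⊑ A → F S ≡ true → ∣ S ∣ ℕ.≤ rank F A
  rank-upper S⊑A = maxWhere-upper F ∣_∣ (subsetsOf-complete S⊑A)

  rank-least : ∀ {r} A → (∀ {S} → S ⊑ A → F S ≡ true → ∣ S ∣ ℕ.≤ r) → rank F A ℕ.≤ r
  rank-least A h = maxWhere-least F ∣_∣ (subsetsOf A) (h ∘ subsetsOf-sound A)

  rank-attained : F ⊥ ≡ true → ∀ A → ∃ λ S → S ⊑ A × F S ≡ true × ∣ S ∣ ≡ rank F A
  rank-attained ∅∈F A with maxWhere-attained F ∣_∣ (subsetsOf A)
  ... | inj₁ ρ≡0               = ⊥ , ⊑-min A , ∅∈F , trans (∣⊥∣≡0 n) (sym ρ≡0)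
  ... | inj₂ (S , S∈ , FS , e) = S , subsetsOf-sound A S∈ , FS , e

  rank≤∣p∣ : ∀ A → rank F A ℕ.≤ ∣ A ∣
  rank≤∣p∣ A = rank-least A (λ S⊑A _ → p⊑q⇒∣p∣≤∣q∣ S⊑A)

  rank-mono : ∀ {S A} → S ⊑ A → rank F S ℕ.≤ rank F A
  rank-mono {S} S⊑A = rank-least S (λ T⊑S FT → rank-upper (⊑-trans T⊑S S⊑A) FT)

  rank≤fullRank : ∀ A → rank F A ℕ.≤ fullRank F
  rank≤fullRank A = rank-mono (⊑-max A)

  rank-feasible : ∀ {A} → F A ≡ true → rank F A ≡ ∣ A ∣
  rank-feasible {A} FA = ℕ.≤-antisym (rank≤∣p∣ A) (rank-upper ⊑-refl FA)

rank-least-++ : ∀ {m n} (F : SetSystem (m ℕ.+ n)) {r} A →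
  (∀ S₁ S₂ → S₁ Vec.++ S₂ ⊑ A → F (S₁ Vec.++ S₂) ≡ true → ∣ S₁ Vec.++ S₂ ∣ ℕ.≤ r) → rank F A ℕ.≤ r
rank-least-++ {m} {n} F {r} A h =
  rank-least F A (λ {S} → ++-elim {m = m} {n} (λ S → S ⊑ A → F S ≡ true → ∣ S ∣ ℕ.≤ r) h S)

sumℤ-++ : ∀ xs ys → sumℤ (xs ++ ys) ≡ sumℤ xs + sumℤ ys
sumℤ-++ []       ys = sym (ℤ.+-identityˡ _)
sumℤ-++ (x ∷ xs) ys = trans (cong (_+_ x) (sumℤ-++ xs ys)) (sym (ℤ.+-assoc x _ _))

sumℤ-map-+ : ∀ {X : Set} (f g : X → ℤ) xs →
             sumℤ (map (λ s → f s + g s) xs) ≡ sumℤ (map f xs) + sumℤ (map g xs)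
sumℤ-map-+ f g []       = refl
sumℤ-map-+ f g (x ∷ xs) = trans (cong (_+_ (f x + g x)) (sumℤ-map-+ f g xs)) (interchange (f x) (g x) _ _)
  where
  interchange : ∀ a b c d → a + b + (c + d) ≡ a + c + (b + d)
  interchange = solve-∀

sumℤ-map-*ˡ : ∀ {X : Set} k (f : X → ℤ) xs → sumℤ (map (λ s → k * f s) xs) ≡ k * sumℤ (map f xs)
sumℤ-map-*ˡ k f []       = sym (ℤ.*-zeroʳ k)
sumℤ-map-*ˡ k f (x ∷ xs) = trans (cong (_+_ (k * f x)) (sumℤ-map-*ˡ k f xs)) (sym (ℤ.*-distribˡ-+ k (f x) _))

sumℤ-map-*ʳ : ∀ {X : Set} k (f : X → ℤ) xs → sumℤ (map (λ s → f s * k) xs) ≡ sumℤ (map f xs) * k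
sumℤ-map-*ʳ k f []       = refl
sumℤ-map-*ʳ k f (x ∷ xs) = trans (cong (_+_ (f x * k)) (sumℤ-map-*ʳ k f xs)) (sym (ℤ.*-distribʳ-+ k (f x) _))

sumSubsets : ∀ {n} → Subset n → (Subset n → ℤ) → ℤ
sumSubsets A f = sumℤ (map f (subsetsOf A))

sumSubsets-cong : ∀ {n} (A : Subset n) {f g} → (∀ S → f S ≡ g S) → sumSubsets A f ≡ sumSubsets A g
sumSubsets-cong A f≗g = cong sumℤ (map-cong f≗g (subsetsOf A))

sumSubsets-∷-true : ∀ {n} (A : Subset n) f →
  sumSubsets (true Vec.∷ A) f ≡ sumSubsets A (f ∘ (true Vec.∷_)) + sumSubsets A (f ∘ (false Vec.∷_))
sumSubsets-∷-true A f = begin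
  sumℤ (map f (map (true Vec.∷_) L ++ map (false Vec.∷_) L))
    ≡⟨ cong sumℤ (map-++ f (map (true Vec.∷_) L) _) ⟩
  sumℤ (map f (map (true Vec.∷_) L) ++ map f (map (false Vec.∷_) L))
    ≡⟨ sumℤ-++ (map f (map (true Vec.∷_) L)) _ ⟩
  sumℤ (map f (map (true Vec.∷_) L)) + sumℤ (map f (map (false Vec.∷_) L))
    ≡⟨ sym (cong₂ _+_ (cong sumℤ (map-∘ L)) (cong sumℤ (map-∘ L))) ⟩
  sumSubsets A (f ∘ (true Vec.∷_)) + sumSubsets A (f ∘ (false Vec.∷_)) ∎
  where
  open ≡-Reasoning
  L = subsetsOf A

sumSubsets-∷-false : ∀ {n} (A : Subset n) f →
  sumSubsets (false Vec.∷ A) f ≡ sumSubsets A (f ∘ (false Vec.∷_))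
sumSubsets-∷-false A f = sym (cong sumℤ (map-∘ (subsetsOf A)))

sumSubsets-*ˡ : ∀ {n} (A : Subset n) k f → sumSubsets A (λ S → k * f S) ≡ k * sumSubsets A f
sumSubsets-*ˡ A k f = sumℤ-map-*ˡ k f (subsetsOf A)

sumSubsets-linear : ∀ {n} (A : Subset n) f g c d →
  sumSubsets A (λ S → f S * c + g S * d) ≡ sumSubsets A f * c + sumSubsets A g * d
sumSubsets-linear A f g c d = trans (sumℤ-map-+ (λ S → f S * c) (λ S → g S * d) L)
  (cong₂ _+_ (sumℤ-map-*ʳ c f L) (sumℤ-map-*ʳ d g L))
  where L = subsetsOf A

sumSubsets-++ : ∀ {m n} (A₁ : Subset m) (A₂ : Subset n) f →
  sumSubsets (A₁ Vec.++ A₂) f ≡ sumSubsets A₁ (λ S₁ → sumSubsets A₂ (λ S₂ → f (S₁ Vec.++ S₂)))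
sumSubsets-++ Vec.[] A₂ f = sym (ℤ.+-identityʳ _)
sumSubsets-++ (true Vec.∷ A₁) A₂ f =
  trans (sumSubsets-∷-true (A₁ Vec.++ A₂) f)
        (trans (cong₂ _+_ (sumSubsets-++ A₁ A₂ _) (sumSubsets-++ A₁ A₂ _)) (sym (sumSubsets-∷-true A₁ _)))
sumSubsets-++ (false Vec.∷ A₁) A₂ f =
  trans (sumSubsets-∷-false (A₁ Vec.++ A₂) f)
        (trans (sumSubsets-++ A₁ A₂ _) (sym (sumSubsets-∷-false A₁ _)))

-- Each element contributes a factor (y - 1) + 1.
sumSubsets-⊤-^∣∣ : ∀ n y → sumSubsets (⊤ {n}) (λ S → (y - + 1) ^ ∣ S ∣) ≡ y ^ n
sumSubsets-⊤-^∣∣ ℕ.zero    y = refl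
sumSubsets-⊤-^∣∣ (ℕ.suc n) y = begin
  sumSubsets (⊤ {ℕ.suc n}) (λ S → (y - + 1) ^ ∣ S ∣)
    ≡⟨ sumSubsets-∷-true (⊤ {n}) (λ S → (y - + 1) ^ ∣ S ∣) ⟩
  sumSubsets ⊤ (λ S → (y - + 1) * f S) + sumSubsets ⊤ f
    ≡⟨ cong (_+ sumSubsets ⊤ f) (sumSubsets-*ˡ ⊤ (y - + 1) f) ⟩
  (y - + 1) * sumSubsets ⊤ f + sumSubsets ⊤ f
    ≡⟨ cong (λ s → (y - + 1) * s + s) (sumSubsets-⊤-^∣∣ n y) ⟩
  (y - + 1) * y ^ n + y ^ n
    ≡⟨ step y (y ^ n) ⟩
  y * y ^ n ∎
  where
  open ≡-Reasoning
  f : Subset n → ℤ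
  f S = (y - + 1) ^ ∣ S ∣
  step : ∀ y s → (y - + 1) * s + s ≡ y * s
  step = solve-∀

tutteTerm : ∀ {n} → SetSystem n → ℤ → ℤ → Subset n → ℤ
tutteTerm F x y A = (x - + 1) ^ (fullRank F ℕ.∸ rank F A) * (y - + 1) ^ (∣ A ∣ ℕ.∸ rank F A)

tutteTerm-fullRank : ∀ {n} (F : SetSystem n) {A} x x′ y → rank F A ≡ fullRank F →
                     tutteTerm F x y A ≡ tutteTerm F x′ y A
tutteTerm-fullRank F {A} x x′ y ρ≡r rewrite ρ≡r | ℕ.n∸n≡0 (fullRank F) = refl

tutteTerm-at-1-deficient : ∀ {n} (F : SetSystem n) {A} y → rank F A ≢ fullRank F →
                        tutteTerm F (+ 1) y A ≡ + 0
tutteTerm-at-1-deficient F {A} y ρ≢r with fullRank F ℕ.∸ rank F A in corank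
... | ℕ.zero  = ⊥-elim (ρ≢r (ℕ.≤-antisym (rank≤fullRank F A) (ℕ.m∸n≡0⇒m≤n corank)))
... | ℕ.suc _ = refl

[m+n]∸[o+p]≡[m∸o]+[n∸p] : ∀ m n o p → o ℕ.≤ m → p ℕ.≤ n → (m ℕ.+ n) ℕ.∸ (o ℕ.+ p) ≡ (m ℕ.∸ o) ℕ.+ (n ℕ.∸ p)
[m+n]∸[o+p]≡[m∸o]+[n∸p] m n o p o≤m p≤n = begin
  (m ℕ.+ n) ℕ.∸ (o ℕ.+ p)   ≡⟨ sym (ℕ.∸-+-assoc (m ℕ.+ n) o p) ⟩
  (m ℕ.+ n) ℕ.∸ o ℕ.∸ p     ≡⟨ cong (ℕ._∸ p) (ℕ.+-∸-comm n o≤m) ⟩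
  (m ℕ.∸ o) ℕ.+ n ℕ.∸ p     ≡⟨ ℕ.+-∸-assoc (m ℕ.∸ o) p≤n ⟩
  (m ℕ.∸ o) ℕ.+ (n ℕ.∸ p)   ∎
  where open ≡-Reasoning

^*^-distrib-+ : ∀ a b i j k l → a ^ (i ℕ.+ j) * b ^ (k ℕ.+ l) ≡ (a ^ i * b ^ k) * (a ^ j * b ^ l)
^*^-distrib-+ a b i j k l = trans (cong₂ _*_ (ℤ.^-distribˡ-+-* a i j) (ℤ.^-distribˡ-+-* b k l))
                          (interchange (a ^ i) (a ^ j) (b ^ k) (b ^ l))
  where
  interchange : ∀ p q r s → p * q * (r * s) ≡ p * r * (q * s)
  interchange = solve-∀

module FullRankAttachment {n₁ n₂} (F₁ : SetSystem n₁) (F₂ : SetSystem n₂)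
                          (∅∈F₁ : F₁ ⊥ ≡ true) (∅∈F₂ : F₂ ⊥ ≡ true) where

  G : SetSystem (n₁ ℕ.+ n₂)
  G = fullRankAttach F₁ F₂

  E₁ : Subset n₁
  E₁ = ⊤
  E₂ : Subset n₂
  E₂ = ⊤

  r₁ r₂ : ℕ
  r₁ = fullRank F₁
  r₂ = fullRank F₂

  c : ℤ → ℤ → ℤ
  c x y = (x - + 1) ^ r₂ * y ^ n₂

  feasible-++ : ∀ S₁ S₂ → G (S₁ Vec.++ S₂) ≡ (isEmpty S₂ ∧ F₁ S₁) ∨ (F₁ S₁ ∧ F₂ S₂ ∧ (rank F₁ S₁ ℕ.≡ᵇ r₁))
  feasible-++ S₁ S₂ rewrite take-++ S₁ S₂ | drop-++ S₁ S₂ = refl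

  feasible-++⁻ : ∀ S₁ S₂ → G (S₁ Vec.++ S₂) ≡ true →
                 F₁ S₁ ≡ true × (∣ S₂ ∣ ≡ 0 ⊎ (F₂ S₂ ≡ true × rank F₁ S₁ ≡ r₁))
  feasible-++⁻ S₁ S₂ GS rewrite feasible-++ S₁ S₂
    with F₁ S₁ | isEmpty S₂ in S₂≡∅ | F₂ S₂ | rank F₁ S₁ ℕ.≡ᵇ r₁ in ρ≡r | GS
  ... | true | true  | _    | _    | _ = refl , inj₁ (isEmpty⇒∣p∣≡0 S₂ S₂≡∅)
  ... | true | false | true | true | _ =
    refl , inj₂ (refl , ℕ.≡ᵇ⇒≡ _ _ (Equivalence.from T-≡ ρ≡r))

  feasible-++⁺ˡ : ∀ {S₁} → F₁ S₁ ≡ true → G (S₁ Vec.++ ⊥ {n₂}) ≡ true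
  feasible-++⁺ˡ {S₁} FS₁ rewrite feasible-++ S₁ ⊥ | FS₁ | isEmpty-⊥ n₂ = refl

  feasible-++⁺ : ∀ {S₁ S₂} → F₁ S₁ ≡ true → F₂ S₂ ≡ true → rank F₁ S₁ ≡ r₁ → G (S₁ Vec.++ S₂) ≡ true
  feasible-++⁺ {S₁} {S₂} FS₁ FS₂ ρ≡r
    rewrite feasible-++ S₁ S₂ | FS₁ | FS₂ | Equivalence.to T-≡ (ℕ.≡⇒≡ᵇ _ _ ρ≡r) = ∨-zeroʳ _

  rank-++-≤ : ∀ A₁ A₂ → rank G (A₁ Vec.++ A₂) ℕ.≤ rank F₁ A₁ ℕ.+ rank F₂ A₂
  rank-++-≤ A₁ A₂ = rank-least-++ {n₁} {n₂} G (A₁ Vec.++ A₂) bound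
    where
    bound : ∀ S₁ S₂ → S₁ Vec.++ S₂ ⊑ A₁ Vec.++ A₂ → G (S₁ Vec.++ S₂) ≡ true →
            ∣ S₁ Vec.++ S₂ ∣ ℕ.≤ rank F₁ A₁ ℕ.+ rank F₂ A₂
    bound S₁ S₂ S⊑A GS with Pointwise.++⁻ S₁ A₁ S⊑A | feasible-++⁻ S₁ S₂ GS
    ... | S₁⊑A₁ , S₂⊑A₂ | FS₁ , S₂-empty-or-feasible =
      subst (ℕ._≤ _) (sym (∣p++q∣≡∣p∣+∣q∣ S₁ S₂))
        (ℕ.+-mono-≤ (rank-upper F₁ S₁⊑A₁ FS₁)
          ([ (λ ∣S₂∣≡0 → subst (ℕ._≤ _) (sym ∣S₂∣≡0) ℕ.z≤n)
           , (λ (FS₂ , _) → rank-upper F₂ S₂⊑A₂ FS₂) ]′ S₂-empty-or-feasible))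

  rank-++-full : ∀ A₁ A₂ → rank F₁ A₁ ≡ r₁ → rank G (A₁ Vec.++ A₂) ≡ rank F₁ A₁ ℕ.+ rank F₂ A₂
  rank-++-full A₁ A₂ ρ₁≡r₁ with rank-attained F₁ ∅∈F₁ A₁ | rank-attained F₂ ∅∈F₂ A₂
  ... | S₁ , S₁⊑A₁ , FS₁ , ∣S₁∣≡ρ₁ | S₂ , S₂⊑A₂ , FS₂ , ∣S₂∣≡ρ₂ =
    ℕ.≤-antisym (rank-++-≤ A₁ A₂) (begin
      rank F₁ A₁ ℕ.+ rank F₂ A₂  ≡⟨ sym (cong₂ ℕ._+_ ∣S₁∣≡ρ₁ ∣S₂∣≡ρ₂) ⟩
      ∣ S₁ ∣ ℕ.+ ∣ S₂ ∣          ≡⟨ sym (∣p++q∣≡∣p∣+∣q∣ S₁ S₂) ⟩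
      ∣ S₁ Vec.++ S₂ ∣           ≤⟨ rank-upper G (Pointwise.++⁺ S₁⊑A₁ S₂⊑A₂) (feasible-++⁺ FS₁ FS₂ ρS₁≡r₁) ⟩
      rank G (A₁ Vec.++ A₂)      ∎)
    where
    open ≤-Reasoning
    ρS₁≡r₁ : rank F₁ S₁ ≡ r₁
    ρS₁≡r₁ = trans (rank-feasible F₁ FS₁) (trans ∣S₁∣≡ρ₁ ρ₁≡r₁)

  rank-++-deficient : ∀ A₁ A₂ → rank F₁ A₁ ≢ r₁ → rank G (A₁ Vec.++ A₂) ≡ rank F₁ A₁
  rank-++-deficient A₁ A₂ ρ₁≢r₁ with rank-attained F₁ ∅∈F₁ A₁
  ... | S₁ , S₁⊑A₁ , FS₁ , ∣S₁∣≡ρ₁ =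
    ℕ.≤-antisym (rank-least-++ {n₁} {n₂} G (A₁ Vec.++ A₂) bound) (begin
      rank F₁ A₁                ≡⟨ sym ∣S₁∣≡ρ₁ ⟩
      ∣ S₁ ∣                    ≡⟨ sym (trans (cong (∣ S₁ ∣ ℕ.+_) (∣⊥∣≡0 n₂)) (ℕ.+-identityʳ _)) ⟩
      ∣ S₁ ∣ ℕ.+ ∣ ⊥ {n₂} ∣     ≡⟨ sym (∣p++q∣≡∣p∣+∣q∣ S₁ ⊥) ⟩
      ∣ S₁ Vec.++ ⊥ ∣           ≤⟨ rank-upper G (Pointwise.++⁺ S₁⊑A₁ (⊑-min A₂)) (feasible-++⁺ˡ FS₁) ⟩
      rank G (A₁ Vec.++ A₂)     ∎)
    where
    open ≤-Reasoning
    bound : ∀ T₁ T₂ → T₁ Vec.++ T₂ ⊑ A₁ Vec.++ A₂ → G (T₁ Vec.++ T₂) ≡ true →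
            ∣ T₁ Vec.++ T₂ ∣ ℕ.≤ rank F₁ A₁
    bound T₁ T₂ T⊑A GT with Pointwise.++⁻ T₁ A₁ T⊑A | feasible-++⁻ T₁ T₂ GT
    ... | T₁⊑A₁ , _ | FT₁ , inj₁ ∣T₂∣≡0 = begin
      ∣ T₁ Vec.++ T₂ ∣      ≡⟨ ∣p++q∣≡∣p∣+∣q∣ T₁ T₂ ⟩
      ∣ T₁ ∣ ℕ.+ ∣ T₂ ∣     ≡⟨ trans (cong (∣ T₁ ∣ ℕ.+_) ∣T₂∣≡0) (ℕ.+-identityʳ _) ⟩
      ∣ T₁ ∣                ≤⟨ rank-upper F₁ T₁⊑A₁ FT₁ ⟩
      rank F₁ A₁            ∎
    ... | T₁⊑A₁ , _ | FT₁ , inj₂ (_ , ρT₁≡r₁) = ⊥-elim (ρ₁≢r₁ (ℕ.≤-antisym (rank≤fullRank F₁ A₁) (begin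
      r₁                    ≡⟨ trans (sym ρT₁≡r₁) (rank-feasible F₁ FT₁) ⟩
      ∣ T₁ ∣                ≤⟨ rank-upper F₁ T₁⊑A₁ FT₁ ⟩
      rank F₁ A₁            ∎)))

  fullRank-attach : fullRank G ≡ r₁ ℕ.+ r₂
  fullRank-attach = trans (cong (rank G) (replicate-++ n₁ true)) (rank-++-full E₁ E₂ refl)

  -- k is the contribution of A₂ to the rank: ρ₂(A₂) when A₁ has full rank, 0 otherwise.
  tutteTerm-++ : ∀ x y S₁ S₂ k → rank G (S₁ Vec.++ S₂) ≡ rank F₁ S₁ ℕ.+ k → k ℕ.≤ r₂ → k ℕ.≤ ∣ S₂ ∣ →
    tutteTerm G x y (S₁ Vec.++ S₂) ≡ tutteTerm F₁ x y S₁ * ((x - + 1) ^ (r₂ ℕ.∸ k) * (y - + 1) ^ (∣ S₂ ∣ ℕ.∸ k))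
  tutteTerm-++ x y S₁ S₂ k ρ≡ρ₁+k k≤r₂ k≤∣S₂∣ = trans
    (cong₂ (λ i j → (x - + 1) ^ i * (y - + 1) ^ j)
      (trans (cong₂ ℕ._∸_ fullRank-attach ρ≡ρ₁+k)
             ([m+n]∸[o+p]≡[m∸o]+[n∸p] r₁ r₂ _ k (rank≤fullRank F₁ S₁) k≤r₂))
      (trans (cong₂ ℕ._∸_ (∣p++q∣≡∣p∣+∣q∣ S₁ S₂) ρ≡ρ₁+k)
             ([m+n]∸[o+p]≡[m∸o]+[n∸p] ∣ S₁ ∣ ∣ S₂ ∣ _ k (rank≤∣p∣ F₁ S₁) k≤∣S₂∣)))
    (^*^-distrib-+ (x - + 1) (y - + 1) (r₁ ℕ.∸ rank F₁ S₁) (r₂ ℕ.∸ k) (∣ S₁ ∣ ℕ.∸ rank F₁ S₁) (∣ S₂ ∣ ℕ.∸ k))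

  sumSubsets-E₂-full : ∀ x y S₁ → rank F₁ S₁ ≡ r₁ →
    sumSubsets E₂ (λ S₂ → tutteTerm G x y (S₁ Vec.++ S₂)) ≡ tutteTerm F₁ x y S₁ * tutte F₂ x y
  sumSubsets-E₂-full x y S₁ ρ₁≡r₁ = trans
    (sumSubsets-cong E₂ (λ S₂ → tutteTerm-++ x y S₁ S₂ (rank F₂ S₂) (rank-++-full S₁ S₂ ρ₁≡r₁)
                                   (rank≤fullRank F₂ S₂) (rank≤∣p∣ F₂ S₂)))
    (sumSubsets-*ˡ E₂ (tutteTerm F₁ x y S₁) (tutteTerm F₂ x y))

  sumSubsets-E₂-deficient : ∀ x y S₁ → rank F₁ S₁ ≢ r₁ →
    sumSubsets E₂ (λ S₂ → tutteTerm G x y (S₁ Vec.++ S₂)) ≡ tutteTerm F₁ x y S₁ * c x y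
  sumSubsets-E₂-deficient x y S₁ ρ₁≢r₁ = begin
    sumSubsets E₂ (λ S₂ → tutteTerm G x y (S₁ Vec.++ S₂))
      ≡⟨ sumSubsets-cong E₂ (λ S₂ → tutteTerm-++ x y S₁ S₂ 0
                                     (trans (rank-++-deficient S₁ S₂ ρ₁≢r₁) (sym (ℕ.+-identityʳ _)))
                                     ℕ.z≤n ℕ.z≤n) ⟩
    sumSubsets E₂ (λ S₂ → t₁ * (xr₂ * (y - + 1) ^ ∣ S₂ ∣))
      ≡⟨ sumSubsets-*ˡ E₂ t₁ _ ⟩
    t₁ * sumSubsets E₂ (λ S₂ → xr₂ * (y - + 1) ^ ∣ S₂ ∣)
      ≡⟨ cong (t₁ *_) (sumSubsets-*ˡ E₂ xr₂ _) ⟩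
    t₁ * (xr₂ * sumSubsets E₂ (λ S₂ → (y - + 1) ^ ∣ S₂ ∣))
      ≡⟨ cong (λ s → t₁ * (xr₂ * s)) (sumSubsets-⊤-^∣∣ n₂ y) ⟩
    t₁ * (xr₂ * y ^ n₂) ∎
    where
    open ≡-Reasoning
    t₁ = tutteTerm F₁ x y S₁
    xr₂ = (x - + 1) ^ r₂

  sumSubsets-E₂ : ∀ x y S₁ →
    sumSubsets E₂ (λ S₂ → tutteTerm G x y (S₁ Vec.++ S₂))
      ≡ tutteTerm F₁ x y S₁ * c x y + tutteTerm F₁ (+ 1) y S₁ * (tutte F₂ x y - c x y)
  sumSubsets-E₂ x y S₁ with rank F₁ S₁ ℕ.≟ r₁
  ... | yes ρ₁≡r₁ = begin
    sumSubsets E₂ (λ S₂ → tutteTerm G x y (S₁ Vec.++ S₂))  ≡⟨ sumSubsets-E₂-full x y S₁ ρ₁≡r₁ ⟩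
    t₁ * T₂                                                ≡⟨ split t₁ T₂ (c x y) ⟩
    t₁ * c x y + t₁ * (T₂ - c x y)                          ≡⟨ cong (λ t → t₁ * c x y + t * (T₂ - c x y))
                                                                    (tutteTerm-fullRank F₁ {S₁} x (+ 1) y ρ₁≡r₁) ⟩
    t₁ * c x y + tutteTerm F₁ (+ 1) y S₁ * (T₂ - c x y)     ∎
    where
    open ≡-Reasoning
    t₁ = tutteTerm F₁ x y S₁
    T₂ = tutte F₂ x y
    split : ∀ t T c → t * T ≡ t * c + t * (T - c)
    split = solve-∀
  ... | no ρ₁≢r₁ = begin
    sumSubsets E₂ (λ S₂ → tutteTerm G x y (S₁ Vec.++ S₂))  ≡⟨ sumSubsets-E₂-deficient x y S₁ ρ₁≢r₁ ⟩
    t₁ * c x y                                             ≡⟨ pad t₁ (c x y) T₂ ⟩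
    t₁ * c x y + + 0 * (T₂ - c x y)                         ≡⟨ cong (λ t → t₁ * c x y + t * (T₂ - c x y))
                                                                    (sym (tutteTerm-at-1-deficient F₁ {S₁} y ρ₁≢r₁)) ⟩
    t₁ * c x y + tutteTerm F₁ (+ 1) y S₁ * (T₂ - c x y)     ∎
    where
    open ≡-Reasoning
    t₁ = tutteTerm F₁ x y S₁
    T₂ = tutte F₂ x y
    pad : ∀ t c T → t * c ≡ t * c + + 0 * (T - c)
    pad = solve-∀

theorem4p5 : ∀ {n₁ n₂ : ℕ} (Γ₁ : Greedoid n₁) (Γ₂ : Greedoid n₂) (x y : ℤ) →
    tutte (fullRankAttach (feasible Γ₁) (feasible Γ₂)) x y
      ≡ tutte (feasible Γ₁) x y * ((x - + 1) ^ fullRank (feasible Γ₂)) * (y ^ n₂)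
        + tutte (feasible Γ₁) (+ 1) y
          * (tutte (feasible Γ₂) x y - (x - + 1) ^ fullRank (feasible Γ₂) * (y ^ n₂))
theorem4p5 {n₁} {n₂} Γ₁ Γ₂ x y = begin
  sumSubsets (⊤ {n₁ ℕ.+ n₂}) (tutteTerm G x y)
    ≡⟨ cong (λ E → sumSubsets E (tutteTerm G x y)) (replicate-++ n₁ true) ⟩
  sumSubsets (E₁ Vec.++ E₂) (tutteTerm G x y)
    ≡⟨ sumSubsets-++ E₁ E₂ (tutteTerm G x y) ⟩
  sumSubsets E₁ (λ S₁ → sumSubsets E₂ (λ S₂ → tutteTerm G x y (S₁ Vec.++ S₂)))
    ≡⟨ sumSubsets-cong E₁ (sumSubsets-E₂ x y) ⟩
  sumSubsets E₁ (λ S₁ → tutteTerm F₁ x y S₁ * c x y + tutteTerm F₁ (+ 1) y S₁ * (tutte F₂ x y - c x y))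
    ≡⟨ sumSubsets-linear E₁ (tutteTerm F₁ x y) (tutteTerm F₁ (+ 1) y) (c x y) (tutte F₂ x y - c x y) ⟩
  tutte F₁ x y * c x y + tutte F₁ (+ 1) y * (tutte F₂ x y - c x y)
    ≡⟨ cong (_+ tutte F₁ (+ 1) y * (tutte F₂ x y - c x y)) (sym (ℤ.*-assoc (tutte F₁ x y) _ _)) ⟩
  tutte F₁ x y * ((x - + 1) ^ r₂) * (y ^ n₂) + tutte F₁ (+ 1) y * (tutte F₂ x y - c x y) ∎
  where
  open ≡-Reasoning
  F₁ = feasible Γ₁
  F₂ = feasible Γ₂
  open FullRankAttachment F₁ F₂ (IsGreedoid.empty-feasible (isGreedoid Γ₁))
                                (IsGreedoid.empty-feasible (isGreedoid Γ₂))
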